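{- A matrix $W_d$ defines an automorphism of $X_\Delta(N)$ if and only if $t_d(\Delta)=\Delta$.
   Context: Let $\Delta$ be a subgroup of $(\mathbb{Z}/N\mathbb{Z})^*$ containing $-1$ and $X_\Delta(N)$ the modular curve associated to $\Gamma_\Delta(N)=\{\begin{pmatrix}a&b\\c&d\end{pmatrix}\in \mathrm{SL}_2(\mathbb{Z}) : c\equiv 0 \bmod N,\ (a \bmod N)\in\Delta\}$. Let $d\mid N$ with $\gcd(d,N/d)=1$, and let $W_d$ denote a matrix of the form $\begin{pmatrix} dx & y\\ Nz & dw\end{pmatrix}$ with $x,y,z,w\in\mathbb{Z}$ and determinant $d$ (such matrices induce the Atkin-Lehner involution $W_d$ on $X_0(N)$). Define the isomorphism $t_d:(\mathbb{Z}/N\mathbb{Z})^*\to(\mathbb{Z}/N\mathbb{Z})^*$ by $t_d(a)\equiv a \pmod{N/d}$ and $t_d(a)\equiv \overline{a}\pmod d$, where $\overline{a}$ is the multiplicative inverse of $a$ modulo $d$. -}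

module Defs where

open import Data.Nat using (ℕ)
open import Data.Integer using (ℤ; +_; -_; _+_; _-_; _*_; 1ℤ)
open import Data.Integer.Divisibility using (_∣_)
open import Data.Product using (Σ; _×_; _,_; ∃)
open import Function.Bundles using (_⇔_)
open import Relation.Binary.PropositionalEquality using (_≡_)

_≡[mod_]_ : ℤ → ℕ → ℤ → Set
x ≡[mod m ] y = (+ m) ∣ (x - y)

IsUnitMod : ℕ → ℤ → Set
IsUnitMod N a = ∃ λ b → (a * b) ≡[mod N ] 1ℤ

-- Δ ⊆ (ℤ/Nℤ)^* given as a predicate on integer representatives
record IsUnitSubgroup (N : ℕ) (Δ : ℤ → Set) : Set where
  field
    respects : ∀ a b → a ≡[mod N ] b → Δ a → Δ b
    units    : ∀ a → Δ a → IsUnitMod N a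
    one      : Δ 1ℤ
    mul      : ∀ a b → Δ a → Δ b → Δ (a * b)
    inv      : ∀ a b → Δ a → (a * b) ≡[mod N ] 1ℤ → Δ b

record IsSubgroupWithMinusOne (N : ℕ) (Δ : ℤ → Set) : Set where
  field
    subgroup : IsUnitSubgroup N Δ
    minusOne : Δ (- 1ℤ)

record Mat : Set where
  constructor mat
  field
    m11 m12 m21 m22 : ℤ

det : Mat → ℤ
det (mat a b c d) = a * d - b * c

_·_ : Mat → Mat → Mat
mat a b c d · mat a' b' c' d' =
  mat (a * a' + b * c') (a * b' + b * d') (c * a' + d * c') (c * b' + d * d')

InGammaDelta : ℕ → (ℤ → Set) → Mat → Set
InGammaDelta N Δ (mat a b c d) = (a * d - b * c ≡ 1ℤ) × ((+ N) ∣ c) × Δ a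

Wmat : ℕ → ℕ → ℤ → ℤ → ℤ → ℤ → Mat
Wmat N d x y z w = mat (+ d * x) y (+ N * z) (+ d * w)

-- W normalizes Γ_Δ(N): W Γ W⁻¹ = Γ, stated without denominators as
-- (∀ γ ∈ Γ, ∃ γ' ∈ Γ, W γ = γ' W) and (∀ γ ∈ Γ, ∃ γ' ∈ Γ, γ W = W γ')
DefinesAutomorphism : ℕ → (ℤ → Set) → Mat → Set
DefinesAutomorphism N Δ W =
  (∀ γ → InGammaDelta N Δ γ → ∃ λ γ' → InGammaDelta N Δ γ' × (W · γ ≡ γ' · W))
  × (∀ γ → InGammaDelta N Δ γ → ∃ λ γ' → InGammaDelta N Δ γ' × (γ · W ≡ W · γ'))

-- b represents t_d(a) in (ℤ/Nℤ)^*, where N = d * e: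
-- b ≡ a mod e and a * b ≡ 1 mod d
IsTd : ℕ → ℕ → ℤ → ℤ → Set
IsTd d e a b = (b ≡[mod e ] a) × ((a * b) ≡[mod d ] 1ℤ)

TdStable : ℕ → ℕ → ℕ → (ℤ → Set) → Set
TdStable N d e Δ =
  (∀ a b → IsUnitMod N a → IsTd d e a b → Δ a → Δ b)
  × (∀ b → Δ b → ∃ λ a → IsUnitMod N a × Δ a × IsTd d e a b)

{-# OPTIONS --safe #-}
module Submission where

-- Since det W = d, conjugation by W is γ ↦ W γ adj(W) / d.  For γ = (a b ; N c δ) of
-- determinant 1 this is an integral matrix of determinant 1, with lower-left entry
-- divisible by N and upper-left entry ≡ a (mod N/d) and ≡ δ ≡ a⁻¹ (mod d): it lies in
-- Γ_{t_d(Δ)}(N).  So W Γ_Δ(N) W⁻¹ ⊆ Γ_Δ(N) exactly when t_d maps Δ into Δ (every a ∈ Δ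
-- being an upper-left entry, and representatives of t_d(a) being unique mod N by the
-- Chinese remainder theorem).  The reverse inclusion W⁻¹ Γ_Δ(N) W ⊆ Γ_Δ(N) is the same
-- statement for adj(W), which is again an Atkin–Lehner matrix of determinant d.

open import Defs
open import Data.Nat using (ℕ; _≥_)
import Data.Nat as ℕ
import Data.Nat.Properties as ℕ
import Data.Nat.Divisibility as ℕ
open import Data.Nat.Coprimality using (Coprime; coprime⇒gcd≡1)
open import Data.Nat.GCD using (gcd)
open import Data.Nat.LCM using (lcm; lcm-least; gcd*lcm)
open import Data.Integer using (ℤ; +_; 1ℤ; -_; _+_; _-_; _*_; NonZero)
open import Data.Integer.Properties
  using (*-comm; *-identityˡ; *-identityʳ; *-cancelˡ-≡; *-cancelʳ-≡; pos-*; neg-distribʳ-*;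
         ∣i-j∣≡∣j-i∣; +-minus-telescope)
open import Data.Integer.Divisibility using (_∣_)
import Data.Integer.Divisibility.Signed as Signed
open import Data.Integer.Tactic.RingSolver using (solve-∀)
open import Data.Product using (_×_; _,_; ∃; ∃₂; map₂)
open import Function.Bundles using (_⇔_; mk⇔)
open import Relation.Binary.PropositionalEquality
  using (_≡_; refl; sym; trans; cong; cong₂; subst; module ≡-Reasoning)
open ≡-Reasoning

adj : Mat → Mat
adj (mat a b c d) = mat d (- b) (- c) a

infixr 8 _⊙_

_⊙_ : ℤ → Mat → Mat
k ⊙ mat a b c d = mat (k * a) (k * b) (k * c) (k * d)

mat-cong : ∀ {a b c d a′ b′ c′ d′} →
  a ≡ a′ → b ≡ b′ → c ≡ c′ → d ≡ d′ → mat a b c d ≡ mat a′ b′ c′ d′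
mat-cong refl refl refl refl = refl

·-assoc : ∀ A B C → (A · B) · C ≡ A · (B · C)
·-assoc (mat a b c d) (mat a′ b′ c′ d′) (mat a″ b″ c″ d″) = mat-cong
  (expand a′ b′ c′ d′ a b a″ c″) (expand a′ b′ c′ d′ a b b″ d″)
  (expand a′ b′ c′ d′ c d a″ c″) (expand a′ b′ c′ d′ c d b″ d″)
  where
  expand : ∀ a′ b′ c′ d′ p q r s → (p * a′ + q * c′) * r + (p * b′ + q * d′) * s
                                 ≡ p * (a′ * r + b′ * s) + q * (c′ * r + d′ * s)
  expand = solve-∀

det-· : ∀ A B → det (A · B) ≡ det A * det B
det-· (mat a b c d) (mat a′ b′ c′ d′) = expand a b c d a′ b′ c′ d′
  where
  expand : ∀ a b c d a′ b′ c′ d′ →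
    (a * a′ + b * c′) * (c * b′ + d * d′) - (a * b′ + b * d′) * (c * a′ + d * c′)
    ≡ (a * d - b * c) * (a′ * d′ - b′ * c′)
  expand = solve-∀

det-adj : ∀ A → det (adj A) ≡ det A
det-adj (mat a b c d) = expand a b c d
  where
  expand : ∀ a b c d → d * a - - b * - c ≡ a * d - b * c
  expand = solve-∀

·-adj-· : ∀ A B → A · (adj A · B) ≡ det A ⊙ B
·-adj-· (mat a b c d) (mat p q r s) =
  mat-cong (top a b c d p r) (top a b c d q s) (bottom a b c d p r) (bottom a b c d q s)
  where
  top : ∀ a b c d u v → a * (d * u + - b * v) + b * (- c * u + a * v) ≡ (a * d - b * c) * u
  top = solve-∀
  bottom : ∀ a b c d u v → c * (d * u + - b * v) + d * (- c * u + a * v) ≡ (a * d - b * c) * v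
  bottom = solve-∀

·-·-adj : ∀ A B → (B · A) · adj A ≡ det A ⊙ B
·-·-adj (mat a b c d) (mat p q r s) =
  mat-cong (left a b c d p q) (right a b c d p q) (left a b c d r s) (right a b c d r s)
  where
  left : ∀ a b c d u v → (u * a + v * c) * d + (u * b + v * d) * - c ≡ (a * d - b * c) * u
  left = solve-∀
  right : ∀ a b c d u v → (u * a + v * c) * - b + (u * b + v * d) * a ≡ (a * d - b * c) * v
  right = solve-∀

⊙-identityˡ : ∀ A → 1ℤ ⊙ A ≡ A
⊙-identityˡ (mat a b c d) =
  mat-cong (*-identityˡ a) (*-identityˡ b) (*-identityˡ c) (*-identityˡ d)

⊙-cancelˡ : ∀ k {A B} .{{_ : NonZero k}} → k ⊙ A ≡ k ⊙ B → A ≡ B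
⊙-cancelˡ k {mat a b c d} {mat a′ b′ c′ d′} eq =
  mat-cong (*-cancelˡ-≡ k a a′ (cong Mat.m11 eq)) (*-cancelˡ-≡ k b b′ (cong Mat.m12 eq))
           (*-cancelˡ-≡ k c c′ (cong Mat.m21 eq)) (*-cancelˡ-≡ k d d′ (cong Mat.m22 eq))

·-cancelʳ : ∀ A {B C} .{{_ : NonZero (det A)}} → B · A ≡ C · A → B ≡ C
·-cancelʳ A {B} {C} eq = ⊙-cancelˡ (det A) (begin
  det A ⊙ B         ≡⟨ sym (·-·-adj A B) ⟩
  (B · A) · adj A   ≡⟨ cong (_· adj A) eq ⟩
  (C · A) · adj A   ≡⟨ ·-·-adj A C ⟩
  det A ⊙ C         ∎)

adj-conjugate : ∀ A {B C} {{_ : NonZero (det A)}} → adj A · B ≡ C · adj A → B · A ≡ A · C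
adj-conjugate A {B} {C} {{det≢0}} eq =
  ·-cancelʳ (adj A) {{subst NonZero (sym (det-adj A)) det≢0}} (begin
  (B · A) · adj A   ≡⟨ ·-·-adj A B ⟩
  det A ⊙ B         ≡⟨ sym (·-adj-· A B) ⟩
  A · (adj A · B)   ≡⟨ cong (A ·_) eq ⟩
  A · (C · adj A)   ≡⟨ sym (·-assoc A C (adj A)) ⟩
  (A · C) · adj A   ∎)

-- x ≡[mod m ] y unfolds to divisibility of absolute values, from which Agda cannot
-- recover m, x and y; this is why they are often passed explicitly below.
≡[mod]-intro : ∀ {m x y} q → x - y ≡ q * + m → x ≡[mod m ] y
≡[mod]-intro q eq = Signed.∣⇒∣ᵤ (Signed.divides q eq)

≡[mod]-sym : ∀ {m x y} → x ≡[mod m ] y → y ≡[mod m ] x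
≡[mod]-sym {m} {x} {y} = subst (m ℕ.∣_) (∣i-j∣≡∣j-i∣ x y)

≡[mod]-trans : ∀ {m x y z} → x ≡[mod m ] y → y ≡[mod m ] z → x ≡[mod m ] z
≡[mod]-trans {m} {x} {y} {z} x≡y y≡z = Signed.∣⇒∣ᵤ
  (subst (Signed._∣_ (+ m)) (+-minus-telescope x y z)
    (Signed.∣m∣n⇒∣m+n (Signed.∣ᵤ⇒∣ {i = x - y} x≡y) (Signed.∣ᵤ⇒∣ {i = y - z} y≡z)))

*-inverse-unique : ∀ {m a p q} → (a * p) ≡[mod m ] 1ℤ → (a * q) ≡[mod m ] 1ℤ → p ≡[mod m ] q
*-inverse-unique {m} {a} {p} {q} ap≡1 aq≡1 = Signed.∣⇒∣ᵤ
  (subst (Signed._∣_ (+ m)) (expand a p q)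
    (Signed.∣m∣n⇒∣m-n (Signed.∣n⇒∣m*n q (Signed.∣ᵤ⇒∣ {i = a * p - 1ℤ} ap≡1))
                       (Signed.∣n⇒∣m*n p (Signed.∣ᵤ⇒∣ {i = a * q - 1ℤ} aq≡1))))
  where
  expand : ∀ a p q → q * (a * p - 1ℤ) - p * (a * q - 1ℤ) ≡ p - q
  expand = solve-∀

coprime⇒≡[mod*] : ∀ {m n x y} → Coprime m n →
  x ≡[mod m ] y → x ≡[mod n ] y → x ≡[mod m ℕ.* n ] y
coprime⇒≡[mod*] {m} {n} m⊥n m∣ n∣ = subst (ℕ._∣ _) lcm≡m*n (lcm-least m∣ n∣)
  where
  lcm≡m*n : lcm m n ≡ m ℕ.* n
  lcm≡m*n = begin
    lcm m n              ≡⟨ sym (ℕ.*-identityˡ (lcm m n)) ⟩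
    1 ℕ.* lcm m n        ≡⟨ cong (ℕ._* lcm m n) (sym (coprime⇒gcd≡1 m⊥n)) ⟩
    gcd m n ℕ.* lcm m n  ≡⟨ gcd*lcm m n ⟩
    m ℕ.* n              ∎

isTd-sym : ∀ {d e a b} → IsTd d e a b → IsTd d e b a
isTd-sym {d} {e} {a} {b} (b≡a , ab≡1) =
  ≡[mod]-sym {e} {b} {a} b≡a , subst (_≡[mod d ] 1ℤ) (*-comm a b) ab≡1

isTd-unique : ∀ {d e a p q} → Coprime d e → IsTd d e a p → IsTd d e a q → p ≡[mod d ℕ.* e ] q
isTd-unique {d} {e} {a} {p} {q} d⊥e (p≡a , ap≡1) (q≡a , aq≡1) =
  coprime⇒≡[mod*] {d} {e} {p} {q} d⊥e (*-inverse-unique {d} {a} {p} {q} ap≡1 aq≡1)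
    (≡[mod]-trans {e} {p} {a} {q} p≡a (≡[mod]-sym {e} {q} {a} q≡a))

TdClosed : ℕ → ℕ → ℕ → (ℤ → Set) → Set
TdClosed N d e Δ = ∀ a b → IsUnitMod N a → IsTd d e a b → Δ a → Δ b

HasTdImagesIn : ℕ → ℕ → (ℤ → Set) → Set
HasTdImagesIn d e Δ = ∀ a → Δ a → ∃ λ b → Δ b × IsTd d e a b

tdImages⇒tdStable : ∀ {d e Δ} → IsUnitSubgroup (d ℕ.* e) Δ → Coprime d e →
  HasTdImagesIn d e Δ → TdStable (d ℕ.* e) d e Δ
tdImages⇒tdStable {d} {e} {Δ} Δ-sg d⊥e image = closed , surjective
  where
  open IsUnitSubgroup Δ-sg
  closed : TdClosed (d ℕ.* e) d e Δ
  closed a b _ a↦b Δa with image a Δa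
  ... | p , Δp , a↦p = respects p b (isTd-unique {d} {e} {a} {p} {b} d⊥e a↦p a↦b) Δp
  surjective : ∀ b → Δ b → ∃ λ a → IsUnitMod (d ℕ.* e) a × Δ a × IsTd d e a b
  surjective b Δb with image b Δb
  ... | a , Δa , b↦a = a , units a Δa , Δa , isTd-sym {d} {e} {b} {a} b↦a

ConjugatesInto : ℕ → (ℤ → Set) → Mat → Set
ConjugatesInto N Δ W = ∀ γ → InGammaDelta N Δ γ → ∃ λ γ′ → InGammaDelta N Δ γ′ × (W · γ ≡ γ′ · W)

conjugatesInto-adj : ∀ {N Δ} A {{_ : NonZero (det A)}} → ConjugatesInto N Δ (adj A) →
  ∀ γ → InGammaDelta N Δ γ → ∃ λ γ′ → InGammaDelta N Δ γ′ × (γ · A ≡ A · γ′)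
conjugatesInto-adj A into γ γ∈Γ = map₂ (map₂ (adj-conjugate A)) (into γ γ∈Γ)

module AtkinLehner (d e : ℕ) (x y z w : ℤ) where

  private
    D E : ℤ
    D = + d
    E = + e

    N : ℕ
    N = d ℕ.* e

  W : Mat
  W = mat (D * x) y (D * E * z) (D * w)

  Wmat≡W : Wmat N d x y z w ≡ W
  Wmat≡W = cong (λ n → mat (D * x) y (n * z) (D * w)) (pos-* d e)

  reducedDet : ℤ
  reducedDet = D * x * w - y * E * z

  det-W : det W ≡ D * reducedDet
  det-W = expand D E x y z w
    where
    expand : ∀ D E x y z w → D * x * (D * w) - y * (D * E * z) ≡ D * (D * x * w - y * E * z)
    expand = solve-∀

  -- the entries of W γ adj(W), divided by D, for γ = mat a b (c * (D * E)) δ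
  conjugate : (a b c δ : ℤ) → Mat
  conjugate a b c δ = mat
    ((D * x * a + y * (c * (D * E))) * w - (D * x * b + y * δ) * E * z)
    (y * δ * x + D * x * x * b - x * a * y - y * y * E * c)
    ((z * a * w + D * w * w * c - E * z * z * b - w * δ * z) * (D * E))
    (D * w * δ * x + D * E * z * b * x - E * z * a * y - D * w * E * c * y)

  conjugate-·-W : ∀ a b c δ → conjugate a b c δ · W ≡ reducedDet ⊙ (W · mat a b (c * (D * E)) δ)
  conjugate-·-W a b c δ = mat-cong
    (entry₁₁ D E x y z w a b c δ) (entry₁₂ D E x y z w a b c δ)
    (entry₂₁ D E x y z w a b c δ) (entry₂₂ D E x y z w a b c δ)
    where
    entry₁₁ : ∀ D E x y z w a b c δ →
      ((D * x * a + y * (c * (D * E))) * w - (D * x * b + y * δ) * E * z) * (D * x)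
        + (y * δ * x + D * x * x * b - x * a * y - y * y * E * c) * (D * E * z)
      ≡ (D * x * w - y * E * z) * (D * x * a + y * (c * (D * E)))
    entry₁₁ = solve-∀
    entry₁₂ : ∀ D E x y z w a b c δ →
      ((D * x * a + y * (c * (D * E))) * w - (D * x * b + y * δ) * E * z) * y
        + (y * δ * x + D * x * x * b - x * a * y - y * y * E * c) * (D * w)
      ≡ (D * x * w - y * E * z) * (D * x * b + y * δ)
    entry₁₂ = solve-∀
    entry₂₁ : ∀ D E x y z w a b c δ →
      (z * a * w + D * w * w * c - E * z * z * b - w * δ * z) * (D * E) * (D * x)
        + (D * w * δ * x + D * E * z * b * x - E * z * a * y - D * w * E * c * y) * (D * E * z)
      ≡ (D * x * w - y * E * z) * (D * E * z * a + D * w * (c * (D * E)))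
    entry₂₁ = solve-∀
    entry₂₂ : ∀ D E x y z w a b c δ →
      (z * a * w + D * w * w * c - E * z * z * b - w * δ * z) * (D * E) * y
        + (D * w * δ * x + D * E * z * b * x - E * z * a * y - D * w * E * c * y) * (D * w)
      ≡ (D * x * w - y * E * z) * (D * E * z * b + D * w * δ)
    entry₂₂ = solve-∀

  conjugate₁₁≡a·reducedDet : ∀ a b c δ →
    Mat.m11 (conjugate a b c δ) ≡[mod e ] (a * reducedDet)
  conjugate₁₁≡a·reducedDet a b c δ =
    ≡[mod]-intro {e} {Mat.m11 (conjugate a b c δ)} {a * reducedDet}
      (y * c * D * w - D * x * b * z - y * δ * z + a * y * z) (expand D E x y z w a b c δ)
    where
    expand : ∀ D E x y z w a b c δ →
      ((D * x * a + y * (c * (D * E))) * w - (D * x * b + y * δ) * E * z) - a * (D * x * w - y * E * z)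
      ≡ (y * c * D * w - D * x * b * z - y * δ * z + a * y * z) * E
    expand = solve-∀

  a·conjugate₁₁≡det·reducedDet : ∀ a b c δ →
    (a * Mat.m11 (conjugate a b c δ)) ≡[mod d ] (det (mat a b (c * (D * E)) δ) * reducedDet)
  a·conjugate₁₁≡det·reducedDet a b c δ =
    ≡[mod]-intro {d} {a * Mat.m11 (conjugate a b c δ)} {det (mat a b (c * (D * E)) δ) * reducedDet}
      (x * a * a * w + a * y * E * c * w - a * x * b * E * z - a * δ * x * w
         + b * E * c * D * x * w - b * E * E * c * y * z)
      (expand D E x y z w a b c δ)
    where
    expand : ∀ D E x y z w a b c δ →
      a * ((D * x * a + y * (c * (D * E))) * w - (D * x * b + y * δ) * E * z)
        - (a * δ - b * (c * (D * E))) * (D * x * w - y * E * z)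
      ≡ (x * a * a * w + a * y * E * c * w - a * x * b * E * z - a * δ * x * w
           + b * E * c * D * x * w - b * E * E * c * y * z) * D
    expand = solve-∀

  N∣⇒multiple : ∀ g → + N ∣ g → ∃ λ c → g ≡ c * (D * E)
  N∣⇒multiple g N∣g with Signed.∣ᵤ⇒∣ {i = g} N∣g
  ... | Signed.divides c g≡c·N = c , trans g≡c·N (cong (c *_) (pos-* d e))

  N∣multiple : ∀ c → + N ∣ c * (D * E)
  N∣multiple c = Signed.∣⇒∣ᵤ (Signed.divides c (cong (c *_) (sym (pos-* d e))))

  module _ {{d≢0 : ℕ.NonZero d}} (det-W≡d : det W ≡ + d) where

    reducedDet≡1 : reducedDet ≡ 1ℤ
    reducedDet≡1 = *-cancelˡ-≡ D reducedDet 1ℤ (begin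
      D * reducedDet   ≡⟨ sym det-W ⟩
      det W            ≡⟨ det-W≡d ⟩
      D                ≡⟨ sym (*-identityʳ D) ⟩
      D * 1ℤ           ∎)

    instance
      nonZero-det-W : NonZero (det W)
      nonZero-det-W = subst NonZero (sym det-W≡d) d≢0

    W·γ≡conjugate·W : ∀ a b c δ → W · mat a b (c * (D * E)) δ ≡ conjugate a b c δ · W
    W·γ≡conjugate·W a b c δ = sym (begin
      conjugate a b c δ · W       ≡⟨ conjugate-·-W a b c δ ⟩
      reducedDet ⊙ (W · γ)        ≡⟨ cong (_⊙ (W · γ)) reducedDet≡1 ⟩
      1ℤ ⊙ (W · γ)                ≡⟨ ⊙-identityˡ (W · γ) ⟩
      W · γ                       ∎)
      where
      γ = mat a b (c * (D * E)) δ

    det-conjugate : ∀ a b c δ → det (conjugate a b c δ) ≡ det (mat a b (c * (D * E)) δ)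
    det-conjugate a b c δ = *-cancelʳ-≡ (det γ′) (det γ) (det W) (begin
      det γ′ * det W   ≡⟨ sym (det-· γ′ W) ⟩
      det (γ′ · W)     ≡⟨ cong det (sym (W·γ≡conjugate·W a b c δ)) ⟩
      det (W · γ)      ≡⟨ det-· W γ ⟩
      det W * det γ    ≡⟨ *-comm (det W) (det γ) ⟩
      det γ * det W    ∎)
      where
      γ  = mat a b (c * (D * E)) δ
      γ′ = conjugate a b c δ

    conjugate-unique : ∀ γ′ a b c δ →
      W · mat a b (c * (D * E)) δ ≡ γ′ · W → γ′ ≡ conjugate a b c δ
    conjugate-unique γ′ a b c δ eq =
      ·-cancelʳ W {γ′} {conjugate a b c δ} (trans (sym eq) (W·γ≡conjugate·W a b c δ))

    conjugate-isTd : ∀ a b c δ → det (mat a b (c * (D * E)) δ) ≡ 1ℤ →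
      IsTd d e a (Mat.m11 (conjugate a b c δ))
    conjugate-isTd a b c δ det≡1 =
        subst (λ t → Mat.m11 (conjugate a b c δ) ≡[mod e ] t)
          (trans (cong (a *_) reducedDet≡1) (*-identityʳ a)) (conjugate₁₁≡a·reducedDet a b c δ)
      , subst (λ t → (a * Mat.m11 (conjugate a b c δ)) ≡[mod d ] t)
          (cong₂ _*_ det≡1 reducedDet≡1) (a·conjugate₁₁≡det·reducedDet a b c δ)

    module _ {Δ : ℤ → Set} (Δ-sg : IsUnitSubgroup N Δ) where

      open IsUnitSubgroup Δ-sg

      conjugate-∈Γ : TdClosed N d e Δ → ∀ {a b c δ} →
        InGammaDelta N Δ (mat a b (c * (D * E)) δ) → InGammaDelta N Δ (conjugate a b c δ)
      conjugate-∈Γ closed {a} {b} {c} {δ} (det≡1 , _ , Δa) =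
          trans (det-conjugate a b c δ) det≡1
        , N∣multiple (z * a * w + D * w * w * c - E * z * z * b - w * δ * z)
        , closed a (Mat.m11 (conjugate a b c δ)) (units a Δa)
            (conjugate-isTd a b c δ det≡1) Δa

      conjugatesInto : TdClosed N d e Δ → ConjugatesInto N Δ W
      conjugatesInto closed (mat a b g δ) γ∈Γ@(_ , N∣g , _) with N∣⇒multiple g N∣g
      ... | c , refl = conjugate a b c δ , conjugate-∈Γ closed γ∈Γ , W·γ≡conjugate·W a b c δ

      top-left-∈Γ : ∀ {a} → Δ a → ∃₂ λ b δ → InGammaDelta N Δ (mat a b (1ℤ * (D * E)) δ)
      top-left-∈Γ {a} Δa with units a Δa
      ... | a′ , aa′≡1 with Signed.∣ᵤ⇒∣ {i = a * a′ - 1ℤ} aa′≡1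
      ... | Signed.divides k aa′-1≡k·N = k , a′ , det≡1 , N∣multiple 1ℤ , Δa
        where
        det≡1 : a * a′ - k * (1ℤ * (D * E)) ≡ 1ℤ
        det≡1 = begin
          a * a′ - k * (1ℤ * (D * E))  ≡⟨ cong (λ t → a * a′ - k * t)
                                             (trans (*-identityˡ (D * E)) (sym (pos-* d e))) ⟩
          a * a′ - k * + N             ≡⟨ cong (λ t → a * a′ - t) (sym aa′-1≡k·N) ⟩
          a * a′ - (a * a′ - 1ℤ)       ≡⟨ expand (a * a′) ⟩
          1ℤ                           ∎
          where
          expand : ∀ u → u - (u - 1ℤ) ≡ 1ℤ
          expand = solve-∀

      conjugatesInto⇒tdImages : ConjugatesInto N Δ W → HasTdImagesIn d e Δ
      conjugatesInto⇒tdImages into a Δa with top-left-∈Γ Δa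
      ... | b , δ , γ∈Γ@(det≡1 , _) with into (mat a b (1ℤ * (D * E)) δ) γ∈Γ
      ... | γ′ , (_ , _ , Δγ′₁₁) , W·γ≡γ′·W =
          Mat.m11 (conjugate a b 1ℤ δ)
        , subst Δ (cong Mat.m11 (conjugate-unique γ′ a b 1ℤ δ W·γ≡γ′·W)) Δγ′₁₁
        , conjugate-isTd a b 1ℤ δ det≡1

adj-W : ∀ d e x y z w → adj (AtkinLehner.W d e x y z w) ≡ AtkinLehner.W d e w (- y) (- z) x
adj-W d e x y z w = cong (λ c → mat (+ d * w) (- y) c (+ d * x)) (neg-distribʳ-* (+ d * + e) z)

lemma1p3 : (N d e : ℕ) → d ≥ 1 → e ≥ 1 → N ≡ d ℕ.* e → Coprime d e →
    (Δ : ℤ → Set) → IsSubgroupWithMinusOne N Δ →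
    (x y z w : ℤ) → det (Wmat N d x y z w) ≡ + d →
    DefinesAutomorphism N Δ (Wmat N d x y z w) ⇔ TdStable N d e Δ
lemma1p3 _ d e d≥1 _ refl d⊥e Δ Δ±1 x y z w det≡d =
  subst (λ M → DefinesAutomorphism (d ℕ.* e) Δ M ⇔ TdStable (d ℕ.* e) d e Δ)
    (sym (AtkinLehner.Wmat≡W d e x y z w)) (mk⇔ ⇒ ⇐)
  where
  instance
    d≢0 : ℕ.NonZero d
    d≢0 = ℕ.>-nonZero d≥1
  open IsSubgroupWithMinusOne Δ±1 using (subgroup)
  open AtkinLehner d e x y z w
  module AdjW = AtkinLehner d e w (- y) (- z) x

  det-W≡d : det W ≡ + d
  det-W≡d = subst (λ M → det M ≡ + d) Wmat≡W det≡d

  det-adjW≡d : det AdjW.W ≡ + d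
  det-adjW≡d = trans (cong det (sym (adj-W d e x y z w))) (trans (det-adj W) det-W≡d)

  ⇒ : DefinesAutomorphism (d ℕ.* e) Δ W → TdStable (d ℕ.* e) d e Δ
  ⇒ (into , _) = tdImages⇒tdStable subgroup d⊥e (conjugatesInto⇒tdImages det-W≡d subgroup into)

  ⇐ : TdStable (d ℕ.* e) d e Δ → DefinesAutomorphism (d ℕ.* e) Δ W
  ⇐ (closed , _) =
      conjugatesInto det-W≡d subgroup closed
    , conjugatesInto-adj W {{nonZero-det-W det-W≡d}}
        (subst (ConjugatesInto (d ℕ.* e) Δ) (sym (adj-W d e x y z w))
          (AdjW.conjugatesInto det-adjW≡d subgroup closed))
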